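{- Let $\phi = \frac{1+\sqrt5}{2}$ and let $F_k$ denote the $k$-th Fibonacci number ($F_0=0$, $F_1=F_2=1$, $F_{k+2}=F_{k+1}+F_k$). If $r$ is an odd positive integer and $n$ is a positive integer, then \[ \Big\lfloor F_r\phi + (\phi-1)\frac{\{n\phi\}}{\phi}\Big\rfloor = F_{r+1}. \]
   Context: $\{x\} = x - \lfloor x\rfloor$ denotes the fractional part. -}

module Defs where

open import Data.Nat as ℕ using (ℕ; zero; suc)
open import Data.Integer as ℤ using (ℤ; +_; 0ℤ; 1ℤ)
open import Data.Product using (_×_; _,_)
open import Data.Sum using (_⊎_)
open import Relation.Binary.PropositionalEquality using (_≡_; _≢_; refl)

F : ℕ → ℕ
F zero = zero
F (suc zero) = suc zero
F (suc (suc k)) = F (suc k) ℕ.+ F k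

-- The ring ℤ[φ] = { a + b φ : a b ∈ ℤ } ⊂ ℝ, φ = (1+√5)/2, φ² = φ + 1.
-- All real numbers occurring in the statement lie in this subring,
-- which is exactly ordered as a subring of ℝ via 'Nonneg' below.
record Zφ : Set where
  constructor _+_φ
  field
    re : ℤ
    ph : ℤ
open Zφ public

infixl 6 _⊕_ _⊖_
infixl 7 _⊗_

_⊕_ : Zφ → Zφ → Zφ
(a + b φ) ⊕ (c + d φ) = (a ℤ.+ c) + (b ℤ.+ d) φ

⊝_ : Zφ → Zφ
⊝ (a + b φ) = (ℤ.- a) + (ℤ.- b) φ

_⊖_ : Zφ → Zφ → Zφ
x ⊖ y = x ⊕ (⊝ y)

-- (a + bφ)(c + dφ) = ac + (ad + bc)φ + bd φ² = (ac + bd) + (ad + bc + bd) φ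
_⊗_ : Zφ → Zφ → Zφ
(a + b φ) ⊗ (c + d φ) = (a ℤ.* c ℤ.+ b ℤ.* d) + (a ℤ.* d ℤ.+ b ℤ.* c ℤ.+ b ℤ.* d) φ

ι : ℤ → Zφ
ι m = m + 0ℤ φ

ιℕ : ℕ → Zφ
ιℕ m = ι (+ m)

φ : Zφ
φ = 0ℤ + 1ℤ φ

φ⁻¹ : Zφ
φ⁻¹ = ℤ.-1ℤ + 1ℤ φ

φ⊗φ⁻¹≡1 : φ ⊗ φ⁻¹ ≡ ι 1ℤ
φ⊗φ⁻¹≡1 = refl

φ⁻¹⊗φ≡1 : φ⁻¹ ⊗ φ ≡ ι 1ℤ
φ⁻¹⊗φ≡1 = refl

_⊘φ : Zφ → Zφ
x ⊘φ = x ⊗ φ⁻¹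

-- Sign of p + q √5 (p q ∈ ℤ) as a real number.
NonnegSqrt5 : ℤ → ℤ → Set
NonnegSqrt5 p q =
    (0ℤ ℤ.≤ p × 0ℤ ℤ.≤ q)
  ⊎ ((0ℤ ℤ.≤ p × q ℤ.< 0ℤ) × (+ 5 ℤ.* (q ℤ.* q) ℤ.≤ p ℤ.* p))
  ⊎ ((p ℤ.< 0ℤ × 0ℤ ℤ.< q) × (p ℤ.* p ℤ.≤ + 5 ℤ.* (q ℤ.* q)))

-- a + b φ = (2a + b + b √5) / 2 ≥ 0 as a real number
Nonneg : Zφ → Set
Nonneg (a + b φ) = NonnegSqrt5 (+ 2 ℤ.* a ℤ.+ b) b

infix 4 _≤φ_ _<φ_
_≤φ_ : Zφ → Zφ → Set
x ≤φ y = Nonneg (y ⊖ x)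

_<φ_ : Zφ → Zφ → Set
x <φ y = (x ≤φ y) × (x ≢ y)

IsFloor : Zφ → ℤ → Set
IsFloor x m = (ι m ≤φ x) × (x <φ ι (m ℤ.+ 1ℤ))

-- Since (φ − 1)/φ = φ⁻², the argument of the floor is F(r+1) + δ + φ⁻²t with
-- t = {nφ} ∈ [0, 1) and δ = F r·φ − F(r+1) = φ⁻ʳ ∈ (0, φ⁻¹] for odd r; as
-- φ⁻¹ + φ⁻² = 1, the excess δ + φ⁻²t lies in [0, 1).
--
-- All numbers involved lie in ℤ[φ], which is ordered through √5-coordinates:
-- a + bφ = (rat + b√5)/2 with rat = 2a + b.  Nonnegativity of a sum is awkward
-- to decide in these coordinates in general, so we work with two cones that are
-- visibly closed under addition, 0 ≤ −rat ≤ b√5 and 0 ≤ −b√5 ≤ rat; closure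
-- reduces to a Cauchy–Schwarz type estimate on integers ('RootLe-+').
module Submission where

open import Defs
open import Data.Nat using (ℕ; _<_; _%_; suc)
open import Data.Integer using (ℤ; +_)
open import Relation.Binary.PropositionalEquality using (_≡_)

open import Data.Nat as ℕ using (zero)
import Data.Nat.Properties as ℕₚ
open import Data.Nat.DivMod using (_/_; m≡m%n+[m/n]*n)
open import Data.Integer as ℤ using (0ℤ; 1ℤ; -1ℤ; _+_; _*_; -_; _-_; _≤_)
import Data.Integer.Properties as ℤₚ
open import Data.Integer.Tactic.RingSolver using (solve-∀)
open import Data.Product using (Σ; _×_; _,_; proj₁; proj₂)
open import Data.Sum using (inj₁; inj₂)
open import Relation.Nullary using (yes; no; contradiction)
open import Relation.Binary.PropositionalEquality
  using (_≢_; refl; sym; trans; cong; cong₂; subst; subst₂; module ≡-Reasoning)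

≤-by-gap : ∀ {x y g} → 0ℤ ≤ g → y ≡ x + g → x ≤ y
≤-by-gap {x} 0≤g refl =
  ℤₚ.≤-trans (ℤₚ.≤-reflexive (sym (ℤₚ.+-identityʳ x))) (ℤₚ.+-monoʳ-≤ x 0≤g)

0≤+ : ∀ n → 0ℤ ≤ + n
0≤+ _ = ℤ.+≤+ ℕ.z≤n

nonneg-+ : ∀ {x y} → 0ℤ ≤ x → 0ℤ ≤ y → 0ℤ ≤ x + y
nonneg-+ = ℤₚ.+-mono-≤

nonneg-* : ∀ {x y} → 0ℤ ≤ x → 0ℤ ≤ y → 0ℤ ≤ x * y
nonneg-* {x} 0≤x 0≤y =
  ℤₚ.≤-trans (ℤₚ.≤-reflexive (sym (ℤₚ.*-zeroʳ x)))
             (ℤₚ.*-monoˡ-≤-nonNeg x ⦃ ℤ.nonNegative 0≤x ⦄ 0≤y)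

*-mono-≤-nonneg : ∀ {x₁ x₂ y₁ y₂} → 0ℤ ≤ x₁ → 0ℤ ≤ y₂ →
  x₁ ≤ y₁ → x₂ ≤ y₂ → x₁ * x₂ ≤ y₁ * y₂
*-mono-≤-nonneg {x₁} {y₂ = y₂} 0≤x₁ 0≤y₂ x₁≤y₁ x₂≤y₂ =
  ℤₚ.≤-trans (ℤₚ.*-monoˡ-≤-nonNeg x₁ ⦃ ℤ.nonNegative 0≤x₁ ⦄ x₂≤y₂)
             (ℤₚ.*-monoʳ-≤-nonNeg y₂ ⦃ ℤ.nonNegative 0≤y₂ ⦄ x₁≤y₁)

square-≤⇒≤ : ∀ {x y} → 0ℤ ≤ y → x * x ≤ y * y → x ≤ y
square-≤⇒≤ {x} {y} 0≤y x²≤y² with x ℤₚ.≤? y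
... | yes x≤y = x≤y
... | no x≰y = contradiction x²≤y² (ℤₚ.<⇒≱ y²<x²)
  where
  y<x = ℤₚ.≰⇒> x≰y
  y²<x² : y * y ℤ.< x * x
  y²<x² = ℤₚ.≤-<-trans (ℤₚ.*-monoˡ-≤-nonNeg y ⦃ ℤ.nonNegative 0≤y ⦄ (ℤₚ.<⇒≤ y<x))
                       (ℤₚ.*-monoʳ-<-pos x ⦃ ℤ.positive (ℤₚ.≤-<-trans 0≤y y<x) ⦄ y<x)

pos-of-double : ∀ {a} → 0ℤ ℤ.< + 2 * a → 0ℤ ℤ.< a
pos-of-double {+ suc n} _ = ℤ.+<+ (ℕ.s≤s ℕ.z≤n)
pos-of-double {+ zero} (ℤ.+<+ ())
pos-of-double { ℤ.-[1+ n ]} ()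

≤0-of-pos-1- : ∀ {a} → 0ℤ ℤ.< 1ℤ - a → a ≤ 0ℤ
≤0-of-pos-1- {a} 0<1-a =
  ≤-by-gap (subst (0ℤ ≤_) (drop-1 a) (ℤₚ.i≤j⇒0≤j-i (ℤₚ.i<j⇒suc[i]≤j 0<1-a)))
           (cancel a)
  where
  drop-1 : ∀ a → 1ℤ - a - 1ℤ ≡ - a
  drop-1 = solve-∀
  cancel : ∀ a → 0ℤ ≡ a + - a
  cancel = solve-∀

-- a·√d ≤ b·√c with the square roots cleared (for a, b, c, d ≥ 0).
RootLe : ℤ → ℤ → ℤ → ℤ → Set
RootLe a d b c = d * (a * a) ≤ c * (b * b)

-- The cone {(a, b) : a√d ≤ b√c} of nonnegative pairs is closed under addition:
-- squaring reduces this to the cross term d·a₁a₂ ≤ c·b₁b₂, whose square is a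
-- product of the two hypotheses.
RootLe-+ : ∀ {a₁ a₂ b₁ b₂ c d} → 0ℤ ≤ c → 0ℤ ≤ d →
  0ℤ ≤ a₁ → 0ℤ ≤ a₂ → 0ℤ ≤ b₁ → 0ℤ ≤ b₂ →
  RootLe a₁ d b₁ c → RootLe a₂ d b₂ c → RootLe (a₁ + a₂) d (b₁ + b₂) c
RootLe-+ {a₁} {a₂} {b₁} {b₂} {c} {d} 0≤c 0≤d 0≤a₁ 0≤a₂ 0≤b₁ 0≤b₂ h₁ h₂ = begin
  d * ((a₁ + a₂) * (a₁ + a₂))                           ≡⟨ expand d a₁ a₂ ⟩
  d * (a₁ * a₁) + d * (a₂ * a₂) + + 2 * (d * (a₁ * a₂))
    ≤⟨ ℤₚ.+-mono-≤ (ℤₚ.+-mono-≤ h₁ h₂) (ℤₚ.*-monoˡ-≤-nonNeg (+ 2) cross) ⟩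
  c * (b₁ * b₁) + c * (b₂ * b₂) + + 2 * (c * (b₁ * b₂)) ≡⟨ expand c b₁ b₂ ⟨
  c * ((b₁ + b₂) * (b₁ + b₂))                           ∎
  where
  open ℤₚ.≤-Reasoning
  expand : ∀ k x y → k * ((x + y) * (x + y)) ≡ k * (x * x) + k * (y * y) + + 2 * (k * (x * y))
  expand = solve-∀
  regroup : ∀ k x y → (k * (x * y)) * (k * (x * y)) ≡ (k * (x * x)) * (k * (y * y))
  regroup = solve-∀
  cross : d * (a₁ * a₂) ≤ c * (b₁ * b₂)
  cross = square-≤⇒≤ (nonneg-* 0≤c (nonneg-* 0≤b₁ 0≤b₂)) (begin
    (d * (a₁ * a₂)) * (d * (a₁ * a₂))   ≡⟨ regroup d a₁ a₂ ⟩
    (d * (a₁ * a₁)) * (d * (a₂ * a₂))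
      ≤⟨ *-mono-≤-nonneg (nonneg-* 0≤d (nonneg-* 0≤a₁ 0≤a₁))
                         (nonneg-* 0≤c (nonneg-* 0≤b₂ 0≤b₂)) h₁ h₂ ⟩
    (c * (b₁ * b₁)) * (c * (b₂ * b₂))   ≡⟨ regroup c b₁ b₂ ⟨
    (c * (b₁ * b₂)) * (c * (b₁ * b₂))   ∎)

_≤√5*_ : ℤ → ℤ → Set
p ≤√5* q = 0ℤ ≤ p × 0ℤ ℤ.< q × RootLe p 1ℤ q (+ 5)

_√5*≤_ : ℤ → ℤ → Set
q √5*≤ p = 0ℤ ≤ p × 0ℤ ≤ q × RootLe q (+ 5) p 1ℤ

≤√5*-+ : ∀ {p₁ p₂ q₁ q₂} → p₁ ≤√5* q₁ → p₂ ≤√5* q₂ → (p₁ + p₂) ≤√5* (q₁ + q₂)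
≤√5*-+ (0≤p₁ , 0<q₁ , h₁) (0≤p₂ , 0<q₂ , h₂) =
  nonneg-+ 0≤p₁ 0≤p₂ , ℤₚ.+-mono-< 0<q₁ 0<q₂ ,
  RootLe-+ (0≤+ 5) (0≤+ 1) 0≤p₁ 0≤p₂ (ℤₚ.<⇒≤ 0<q₁) (ℤₚ.<⇒≤ 0<q₂) h₁ h₂

√5*≤-+ : ∀ {p₁ p₂ q₁ q₂} → q₁ √5*≤ p₁ → q₂ √5*≤ p₂ → (q₁ + q₂) √5*≤ (p₁ + p₂)
√5*≤-+ (0≤p₁ , 0≤q₁ , h₁) (0≤p₂ , 0≤q₂ , h₂) =
  nonneg-+ 0≤p₁ 0≤p₂ , nonneg-+ 0≤q₁ 0≤q₂ ,
  RootLe-+ (0≤+ 1) (0≤+ 5) 0≤q₁ 0≤q₂ 0≤p₁ 0≤p₂ h₁ h₂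

-- Twice the rational part: x = (rat x + ph x·√5)/2, so that 'Nonneg x' is the
-- sign condition 'NonnegSqrt5 (rat x) (ph x)'.
rat : Zφ → ℤ
rat x = + 2 * re x + ph x

Zφ-≡ : ∀ {x y} → re x ≡ re y → ph x ≡ ph y → x ≡ y
Zφ-≡ refl refl = refl

rat-⊕ : ∀ x y → rat (x ⊕ y) ≡ rat x + rat y
rat-⊕ x y = identity (re x) (ph x) (re y) (ph y)
  where
  identity : ∀ a b c d → + 2 * (a + c) + (b + d) ≡ (+ 2 * a + b) + (+ 2 * c + d)
  identity = solve-∀

Cone⁻ : Zφ → Set
Cone⁻ x = (- rat x) ≤√5* ph x

Cone⁺ : Zφ → Set
Cone⁺ x = (- ph x) √5*≤ rat x

Cone⁻-⊕ : ∀ {x y} → Cone⁻ x → Cone⁻ y → Cone⁻ (x ⊕ y)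
Cone⁻-⊕ {x} {y} cx cy =
  subst (_≤√5* (ph x + ph y))
        (sym (trans (cong -_ (rat-⊕ x y)) (ℤₚ.neg-distrib-+ (rat x) (rat y))))
        (≤√5*-+ cx cy)

Cone⁺-⊕ : ∀ {x y} → Cone⁺ x → Cone⁺ y → Cone⁺ (x ⊕ y)
Cone⁺-⊕ {x} {y} cx cy =
  subst₂ _√5*≤_ (sym (ℤₚ.neg-distrib-+ (ph x) (ph y))) (sym (rat-⊕ x y)) (√5*≤-+ cx cy)

neg-square : ∀ p → - p * - p ≡ p * p
neg-square = solve-∀

Cone⁻⇒Nonneg : ∀ {x} → Cone⁻ x → Nonneg x
Cone⁻⇒Nonneg {x} (_ , 0<ph , bound) with 0ℤ ℤₚ.≤? rat x
... | yes 0≤rat = inj₁ (0≤rat , ℤₚ.<⇒≤ 0<ph)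
... | no 0≰rat  = inj₂ (inj₂ ((ℤₚ.≰⇒> 0≰rat , 0<ph) ,
  subst (_≤ + 5 * (ph x * ph x)) (trans (ℤₚ.*-identityˡ _) (neg-square (rat x))) bound))

Cone⁺⇒Nonneg : ∀ {x} → Cone⁺ x → Nonneg x
Cone⁺⇒Nonneg {x} (0≤rat , _ , bound) with 0ℤ ℤₚ.≤? ph x
... | yes 0≤ph = inj₁ (0≤rat , 0≤ph)
... | no 0≰ph  = inj₂ (inj₁ ((0≤rat , ℤₚ.≰⇒> 0≰ph) ,
  subst₂ _≤_ (cong (+ 5 *_) (neg-square (ph x))) (ℤₚ.*-identityˡ _) bound))

rat²≤5ph² : ∀ {x} → Nonneg x → re x ≤ 0ℤ → 0ℤ ℤ.< ph x →
  rat x * rat x ≤ + 5 * (ph x * ph x)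
rat²≤5ph² {x} (inj₁ (0≤rat , _)) re≤0 0<ph = ≤-by-gap gap≥0 (identity (re x) (ph x))
  where
  -- here 0 ≤ rat x ≤ ph x
  identity : ∀ a b → + 5 * (b * b) ≡
    (+ 2 * a + b) * (+ 2 * a + b) + ((+ 2 * - a) * (b + (+ 2 * a + b)) + + 4 * (b * b))
  identity = solve-∀
  0≤ph = ℤₚ.<⇒≤ 0<ph
  gap≥0 : 0ℤ ≤ (+ 2 * - re x) * (ph x + rat x) + + 4 * (ph x * ph x)
  gap≥0 = nonneg-+ (nonneg-* (nonneg-* (0≤+ 2) (ℤₚ.neg-mono-≤ re≤0)) (nonneg-+ 0≤ph 0≤rat))
                   (nonneg-* (0≤+ 4) (nonneg-* 0≤ph 0≤ph))
rat²≤5ph² (inj₂ (inj₁ ((_ , ph<0) , _))) _ 0<ph = contradiction ph<0 (ℤₚ.<-asym 0<ph)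
rat²≤5ph² (inj₂ (inj₂ (_ , bound))) _ _ = bound

negative-ph-bounds : ∀ {y} → Nonneg y → ph y ℤ.< 0ℤ →
  0ℤ ℤ.< re y × + 5 * (ph y * ph y) ≤ rat y * rat y
negative-ph-bounds (inj₁ (_ , 0≤ph)) ph<0 = contradiction 0≤ph (ℤₚ.<⇒≱ ph<0)
negative-ph-bounds {y} (inj₂ (inj₁ ((0≤rat , ph<0) , bound))) _ =
  pos-of-double (subst (0ℤ ℤ.<_) (cancel (re y) (ph y))
                       (ℤₚ.+-mono-≤-< 0≤rat (ℤₚ.neg-mono-< ph<0))) ,
  bound
  where
  cancel : ∀ a b → (+ 2 * a + b) + - b ≡ + 2 * a
  cancel = solve-∀
negative-ph-bounds (inj₂ (inj₂ ((_ , 0<ph) , _))) ph<0 = contradiction ph<0 (ℤₚ.<-asym 0<ph)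

-- (a + bφ)·φ⁻² = (a + bφ)(2 − φ) = (2a − b) + (b − a)φ.
_⊘φ² : Zφ → Zφ
x ⊘φ² = record { re = + 2 * re x - ph x ; ph = ph x - re x }

⊘φ²-spec : ∀ x → ((φ ⊖ ιℕ 1) ⊗ x) ⊘φ ≡ x ⊘φ²
⊘φ²-spec x = Zφ-≡ (re-identity (re x) (ph x)) (ph-identity (re x) (ph x))
  where
  re-identity : ∀ a b →
    (-1ℤ * a + 1ℤ * b) * -1ℤ + (-1ℤ * b + 1ℤ * a + 1ℤ * b) * 1ℤ ≡ + 2 * a - b
  re-identity = solve-∀
  ph-identity : ∀ a b →
    (-1ℤ * a + 1ℤ * b) * 1ℤ + (-1ℤ * b + 1ℤ * a + 1ℤ * b) * -1ℤ
      + (-1ℤ * b + 1ℤ * a + 1ℤ * b) * 1ℤ ≡ b - a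
  ph-identity = solve-∀

-- φ⁻² maps a nonnegative x with re x ≤ 0 < ph x into Cone⁻; the bound on
-- rat (x ⊘φ²) is the bound on rat x, as multiplication by the unit φ⁻² of
-- norm 1 preserves rat² − 5·ph².
⊘φ²-Cone⁻ : ∀ {x} → Nonneg x → re x ≤ 0ℤ → 0ℤ ℤ.< ph x → Cone⁻ (x ⊘φ²)
⊘φ²-Cone⁻ {x} x≥0 re≤0 0<ph =
  subst (_≤√5* (ph x - re x)) (sym (neg-rat (re x) (ph x)))
    ( nonneg-+ (ℤₚ.<⇒≤ 0<ph) (nonneg-* (0≤+ 3) 0≤-re)
    , ℤₚ.+-mono-<-≤ 0<ph 0≤-re
    , ≤-by-gap (ℤₚ.i≤j⇒0≤j-i (rat²≤5ph² x≥0 re≤0 0<ph)) (norm-shift (re x) (ph x)))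
  where
  0≤-re = ℤₚ.neg-mono-≤ re≤0
  neg-rat : ∀ a b → - (+ 2 * (+ 2 * a - b) + (b - a)) ≡ b + + 3 * - a
  neg-rat = solve-∀
  norm-shift : ∀ a b → + 5 * ((b - a) * (b - a)) ≡
    1ℤ * ((b + + 3 * - a) * (b + + 3 * - a))
      + (+ 5 * (b * b) - (+ 2 * a + b) * (+ 2 * a + b))
  norm-shift = solve-∀

⊘φ²-Cone⁺ : ∀ {y} → Nonneg y → ph y ℤ.< 0ℤ → Cone⁺ (y ⊘φ²) × ph (y ⊘φ²) ℤ.< 0ℤ
⊘φ²-Cone⁺ {y} y≥0 ph<0 =
  subst₂ _√5*≤_ (sym (neg-ph (re y) (ph y))) (sym (rat-form (re y) (ph y)))
    ( nonneg-+ (nonneg-* (0≤+ 3) (ℤₚ.<⇒≤ 0<re)) 0≤-ph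
    , nonneg-+ (ℤₚ.<⇒≤ 0<re) 0≤-ph
    , ≤-by-gap (ℤₚ.i≤j⇒0≤j-i bound) (norm-shift (re y) (ph y))) ,
  ℤₚ.+-mono-< ph<0 (ℤₚ.neg-mono-< 0<re)
  where
  0<re = proj₁ (negative-ph-bounds {y} y≥0 ph<0)
  bound = proj₂ (negative-ph-bounds {y} y≥0 ph<0)
  0≤-ph = ℤₚ.<⇒≤ (ℤₚ.neg-mono-< ph<0)
  neg-ph : ∀ a b → - (b - a) ≡ a + - b
  neg-ph = solve-∀
  rat-form : ∀ a b → + 2 * (+ 2 * a - b) + (b - a) ≡ + 3 * a + - b
  rat-form = solve-∀
  norm-shift : ∀ a b → 1ℤ * ((+ 3 * a + - b) * (+ 3 * a + - b)) ≡
    + 5 * ((a + - b) * (a + - b))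
      + ((+ 2 * a + b) * (+ 2 * a + b) - + 5 * (b * b))
  norm-shift = solve-∀

Fℤ : ℕ → ℤ
Fℤ r = + F r

0≤Fℤ : ∀ k → 0ℤ ≤ Fℤ k
0≤Fℤ k = 0≤+ (F k)

Fℤ-rec : ∀ k → Fℤ (suc (suc k)) ≡ Fℤ (suc k) + Fℤ k
Fℤ-rec k = ℤₚ.pos-+ (F (suc k)) (F k)

Fℤ-rec₂ : ∀ k → Fℤ (suc (suc (suc k))) ≡ (Fℤ (suc k) + Fℤ k) + Fℤ (suc k)
Fℤ-rec₂ k = trans (Fℤ-rec (suc k)) (cong (_+ Fℤ (suc k)) (Fℤ-rec k))

F-suc-pos : ∀ k → 0 < F (suc k)
F-suc-pos zero = ℕ.s≤s ℕ.z≤n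
F-suc-pos (suc k) = ℕₚ.<-≤-trans (F-suc-pos k) (ℕₚ.m≤m+n (F (suc k)) (F k))

odd : ℕ → ℕ
odd m = suc (m ℕ.* 2)

-- The Cassini form b² − ab − a²; Cassini's identity says it is (−1)^(k+1)
-- at (a, b) = (F k, F (k+1)).
cassini : ℤ → ℤ → ℤ
cassini a b = b * b - a * b - a * a

cassini-step : ∀ a b → cassini (b + a) ((b + a) + b) ≡ cassini a b
cassini-step = identity
  where
  identity : ∀ a b → ((b + a) + b) * ((b + a) + b) - (b + a) * ((b + a) + b) - (b + a) * (b + a)
                   ≡ b * b - a * b - a * a
  identity = solve-∀

cassini-odd : ∀ m → cassini (Fℤ (m ℕ.* 2)) (Fℤ (odd m)) ≡ 1ℤ
cassini-odd zero = refl
cassini-odd (suc m) = begin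
  cassini (Fℤ (suc (suc k))) (Fℤ (suc (suc (suc k))))  ≡⟨ cong₂ cassini (Fℤ-rec k) (Fℤ-rec₂ k) ⟩
  cassini (b + a) ((b + a) + b)                         ≡⟨ cassini-step a b ⟩
  cassini a b                                           ≡⟨ cassini-odd m ⟩
  1ℤ                                                    ∎
  where
  open ≡-Reasoning
  k = m ℕ.* 2
  a = Fℤ k
  b = Fℤ (suc k)

-- F(2m) + 2 ≤ 2·F(2m+1); this is what makes φ⁻¹ − fibError r ≥ 0 (an equality
-- for r = 1).
fib-odd-bound : ∀ m → Fℤ (m ℕ.* 2) + + 2 ≤ + 2 * Fℤ (odd m)
fib-odd-bound zero = ℤₚ.≤-refl
fib-odd-bound (suc m) =
  subst₂ (λ a′ b′ → a′ + + 2 ≤ + 2 * b′) (sym (Fℤ-rec k)) (sym (Fℤ-rec₂ k)) (begin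
    (b + a) + + 2        ≡⟨ ℤₚ.+-assoc b a (+ 2) ⟩
    b + (a + + 2)        ≤⟨ ℤₚ.+-monoʳ-≤ b (fib-odd-bound m) ⟩
    b + + 2 * b          ≤⟨ ≤-by-gap (nonneg-+ (0≤Fℤ (suc k)) (nonneg-* (0≤+ 2) (0≤Fℤ k)))
                                     (regroup a b) ⟩
    + 2 * ((b + a) + b)  ∎)
  where
  open ℤₚ.≤-Reasoning
  k = m ℕ.* 2
  a = Fℤ k
  b = Fℤ (suc k)
  regroup : ∀ a b → + 2 * ((b + a) + b) ≡ (b + + 2 * b) + (b + + 2 * a)
  regroup = solve-∀

-- The error F r·φ − F (r+1) of the Fibonacci approximation of φ; for odd r
-- it equals φ⁻ʳ ∈ (0, φ⁻¹].
fibError : ℕ → Zφ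
fibError r = ιℕ (F r) ⊗ φ ⊖ ιℕ (F (suc r))

mφ-n-re : ∀ m n → re (ι m ⊗ φ ⊖ ι n) ≡ - n
mφ-n-re = identity
  where
  identity : ∀ m n → m * 0ℤ + 0ℤ * 1ℤ - n ≡ - n
  identity = solve-∀

mφ-n-ph : ∀ m n → ph (ι m ⊗ φ ⊖ ι n) ≡ m
mφ-n-ph = identity
  where
  identity : ∀ m n → m * 1ℤ + 0ℤ * 0ℤ + 0ℤ * 1ℤ - 0ℤ ≡ m
  identity = solve-∀

fibError-ph : ∀ k → ph (fibError k) ≡ Fℤ k
fibError-ph k = mφ-n-ph (Fℤ k) (Fℤ (suc k))

fibError-re : ∀ k → re (fibError (suc k)) ≡ - (Fℤ (suc k) + Fℤ k)
fibError-re k = trans (mφ-n-re (Fℤ (suc k)) (Fℤ (suc (suc k)))) (cong -_ (Fℤ-rec k))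

-- With (a, b) = (F(r−1), F r), fibError r = (−(2a + b) + b√5)/2, and
-- 5b² − (2a + b)² = 4·cassini a b = 4.
fibError-Cone⁻ : ∀ m → Cone⁻ (fibError (odd m))
fibError-Cone⁻ m =
  subst₂ _≤√5*_ (sym (trans (cong₂ (λ r p → - (+ 2 * r + p))
                                   (fibError-re k) (fibError-ph (suc k)))
                            (neg-rat a b)))
                (sym (fibError-ph (suc k)))
    ( nonneg-+ (nonneg-* (0≤+ 2) (0≤Fℤ k)) (0≤Fℤ (suc k))
    , ℤ.+<+ (F-suc-pos k)
    , ≤-by-gap (subst (λ c → 0ℤ ≤ + 4 * c) (sym (cassini-odd m)) (0≤+ 4)) (norm a b))
  where
  k = m ℕ.* 2
  a = Fℤ k
  b = Fℤ (suc k)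
  neg-rat : ∀ a b → - (+ 2 * - (b + a) + b) ≡ + 2 * a + b
  neg-rat = solve-∀
  norm : ∀ a b → + 5 * (b * b) ≡
    1ℤ * ((+ 2 * a + b) * (+ 2 * a + b)) + + 4 * (b * b - a * b - a * a)
  norm = solve-∀

-- φ⁻¹ − fibError r = ((2a + b − 1) − (b − 1)√5)/2, and
-- (2a + b − 1)² − 5(b − 1)² = 4(2b − a − 2) + 4(1 − cassini a b).
φ⁻¹-fibError-Cone⁺ : ∀ m → Cone⁺ (φ⁻¹ ⊖ fibError (odd m))
φ⁻¹-fibError-Cone⁺ m =
  subst₂ _√5*≤_ (sym (trans (cong (λ p → - (1ℤ - p)) (fibError-ph (suc k))) (neg-ph b)))
                (sym (trans (cong₂ (λ r p → + 2 * (-1ℤ - r) + (1ℤ - p))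
                                   (fibError-re k) (fibError-ph (suc k)))
                            (rat-form a b)))
    ( nonneg-+ (nonneg-* (0≤+ 2) (0≤Fℤ k)) 0≤b-1
    , 0≤b-1
    , ≤-by-gap (nonneg-+ (nonneg-* (0≤+ 4) (ℤₚ.i≤j⇒0≤j-i (fib-odd-bound m)))
                         (subst (λ c → 0ℤ ≤ + 4 * (1ℤ - c)) (sym (cassini-odd m)) (0≤+ 0)))
               (norm a b))
  where
  k = m ℕ.* 2
  a = Fℤ k
  b = Fℤ (suc k)
  0≤b-1 : 0ℤ ≤ b - 1ℤ
  0≤b-1 = ℤₚ.i≤j⇒0≤j-i (ℤₚ.i<j⇒suc[i]≤j (ℤ.+<+ (F-suc-pos k)))
  neg-ph : ∀ b → - (1ℤ - b) ≡ b - 1ℤ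
  neg-ph = solve-∀
  rat-form : ∀ a b → + 2 * (-1ℤ - - (b + a)) + (1ℤ - b) ≡ + 2 * a + (b - 1ℤ)
  rat-form = solve-∀
  norm : ∀ a b → 1ℤ * ((+ 2 * a + (b - 1ℤ)) * (+ 2 * a + (b - 1ℤ))) ≡
    + 5 * ((b - 1ℤ) * (b - 1ℤ))
      + (+ 4 * (+ 2 * b - (a + + 2)) + + 4 * (1ℤ - (b * b - a * b - a * a)))
  norm = solve-∀

⊕-⊖-swap : ∀ x s y → (x ⊕ s) ⊖ y ≡ (x ⊖ y) ⊕ s
⊕-⊖-swap x s y = Zφ-≡ (swap (re x) (re s) (re y)) (swap (ph x) (ph s) (ph y))
  where
  swap : ∀ a b c → a + b - c ≡ a - c + b
  swap = solve-∀

-- (b + 1) − (x + φ⁻²t) = (φ⁻¹ − (x − b)) + φ⁻²(1 − t), because φ⁻¹ + φ⁻² = 1.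
complement-split : ∀ x b t → ι (b + 1ℤ) ⊖ (x ⊕ t ⊘φ²) ≡ (φ⁻¹ ⊖ (x ⊖ ι b)) ⊕ (ι 1ℤ ⊖ t) ⊘φ²
complement-split x b t =
  Zφ-≡ (re-identity (re x) b (re t) (ph t)) (ph-identity (ph x) (re t) (ph t))
  where
  re-identity : ∀ r b t₁ t₂ → b + 1ℤ - (r + (+ 2 * t₁ - t₂)) ≡
    -1ℤ - (r - b) + (+ 2 * (1ℤ - t₁) - (0ℤ - t₂))
  re-identity = solve-∀
  ph-identity : ∀ p t₁ t₂ → 0ℤ - (p + (t₂ - t₁)) ≡ 1ℤ - (p - 0ℤ) + ((0ℤ - t₂) - (1ℤ - t₁))
  ph-identity = solve-∀

shift-split : ∀ y k → ι (k + 1ℤ) ⊖ y ≡ ι 1ℤ ⊖ (y ⊖ ι k)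
shift-split y k = Zφ-≡ (re-identity (re y) k) (ph-identity (ph y))
  where
  re-identity : ∀ r k → k + 1ℤ - r ≡ 1ℤ - (r - k)
  re-identity = solve-∀
  ph-identity : ∀ p → 0ℤ - p ≡ 0ℤ - (p - 0ℤ)
  ph-identity = solve-∀

distinct-by-ph : ∀ {x y} → ph (y ⊖ x) ≢ 0ℤ → x ≢ y
distinct-by-ph {y = y} ph≢0 refl = ph≢0 (ℤₚ.+-inverseʳ (ph y))

-- ⌊ F r·φ + φ⁻²t ⌋ = F (r+1) for odd r and any t ∈ [0, 1] ∩ ℤ[φ] with
-- positive φ-part: below, the excess is fibError r + φ⁻²t ∈ Cone⁻; above, the
-- deficit is (φ⁻¹ − fibError r) + φ⁻²(1 − t) ∈ Cone⁺ with negative φ-part.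
floor-shift : ∀ m t → 0ℤ ℤ.< ph t → Nonneg t → Nonneg (ι 1ℤ ⊖ t) →
  IsFloor (ιℕ (F (odd m)) ⊗ φ ⊕ t ⊘φ²) (Fℤ (suc (odd m)))
floor-shift m t 0<ph t≥0 1-t≥0 = lower , upper , distinct-by-ph (ℤₚ.<⇒≢ deficit-ph<0)
  where
  x = ιℕ (F (odd m)) ⊗ φ
  b = Fℤ (suc (odd m))
  ph[1-t]<0 : ph (ι 1ℤ ⊖ t) ℤ.< 0ℤ
  ph[1-t]<0 = subst (ℤ._< 0ℤ) (sym (ℤₚ.+-identityˡ (- ph t))) (ℤₚ.neg-mono-< 0<ph)
  re≤0 : re t ≤ 0ℤ
  re≤0 = ≤0-of-pos-1- (proj₁ (negative-ph-bounds {ι 1ℤ ⊖ t} 1-t≥0 ph[1-t]<0))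
  excess : Cone⁻ (fibError (odd m) ⊕ t ⊘φ²)
  excess = Cone⁻-⊕ {fibError (odd m)} {t ⊘φ²}
    (fibError-Cone⁻ m) (⊘φ²-Cone⁻ {t} t≥0 re≤0 0<ph)
  lower : Nonneg ((x ⊕ t ⊘φ²) ⊖ ι b)
  lower = subst Nonneg (sym (⊕-⊖-swap x (t ⊘φ²) (ι b)))
    (Cone⁻⇒Nonneg {fibError (odd m) ⊕ t ⊘φ²} excess)
  [1-t]⊘φ² : Cone⁺ ((ι 1ℤ ⊖ t) ⊘φ²) × ph ((ι 1ℤ ⊖ t) ⊘φ²) ℤ.< 0ℤ
  [1-t]⊘φ² = ⊘φ²-Cone⁺ {ι 1ℤ ⊖ t} 1-t≥0 ph[1-t]<0
  deficit : Cone⁺ ((φ⁻¹ ⊖ fibError (odd m)) ⊕ (ι 1ℤ ⊖ t) ⊘φ²)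
  deficit = Cone⁺-⊕ {φ⁻¹ ⊖ fibError (odd m)} {(ι 1ℤ ⊖ t) ⊘φ²}
    (φ⁻¹-fibError-Cone⁺ m) (proj₁ [1-t]⊘φ²)
  upper : Nonneg (ι (b + 1ℤ) ⊖ (x ⊕ t ⊘φ²))
  upper = subst Nonneg (sym (complement-split x b t))
    (Cone⁺⇒Nonneg {(φ⁻¹ ⊖ fibError (odd m)) ⊕ (ι 1ℤ ⊖ t) ⊘φ²} deficit)
  deficit-ph<0 : ph (ι (b + 1ℤ) ⊖ (x ⊕ t ⊘φ²)) ℤ.< 0ℤ
  deficit-ph<0 = subst (ℤ._< 0ℤ) (sym (cong ph (complement-split x b t)))
    (ℤₚ.+-mono-≤-< ph≤0 (proj₂ [1-t]⊘φ²))
    where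
    ph≤0 : ph (φ⁻¹ ⊖ fibError (odd m)) ≤ 0ℤ
    ph≤0 = ℤₚ.neg-cancel-≤ (proj₁ (proj₂ (φ⁻¹-fibError-Cone⁺ m)))

odd-form : ∀ r → r % 2 ≡ 1 → Σ ℕ λ m → r ≡ odd m
odd-form r r%2≡1 = r / 2 , trans (m≡m%n+[m/n]*n r 2) (cong (ℕ._+ (r / 2) ℕ.* 2) r%2≡1)

lemma3p11 : (r n : ℕ) → r % 2 ≡ 1 → 0 < r → 0 < n →
    (k : ℤ) → IsFloor (ιℕ n ⊗ φ) k →
    IsFloor (ιℕ (F r) ⊗ φ ⊕ ((φ ⊖ ιℕ 1) ⊗ (ιℕ n ⊗ φ ⊖ ι k)) ⊘φ) (+ F (suc r))
lemma3p11 r n r-odd _ 0<n k (k≤nφ , nφ≤k+1 , _) with odd-form r r-odd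
... | m , refl =
  subst (λ s → IsFloor (ιℕ (F (odd m)) ⊗ φ ⊕ s) (Fℤ (suc (odd m)))) (sym (⊘φ²-spec t))
    (floor-shift m t 0<ph[t] k≤nφ (subst Nonneg (shift-split (ιℕ n ⊗ φ) k) nφ≤k+1))
  where
  t = ιℕ n ⊗ φ ⊖ ι k
  0<ph[t] : 0ℤ ℤ.< ph t
  0<ph[t] = subst (0ℤ ℤ.<_) (sym (mφ-n-ph (+ n) k)) (ℤ.+<+ 0<n)
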